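{- Let $D_0,D_1,\dots,D_l$ be an $i$-string in a $\sqrt{\mathfrak{gl}_n}$-crystal. Then $$\pi^K_i\big(x^{\mathrm{wt}(D_0)}\big)=\sum_{j=0}^lx^{\mathrm{wt}(D_j)}\quad\text{and}\quad\pi^K_i\Big(\sum_{j=0}^lx^{\mathrm{wt}(D_j)}\Big)=\sum_{j=0}^lx^{\mathrm{wt}(D_j)}.$$
   Context: $[n]=\{1,\dots,n\}$, $\mathbf{e}_k$ standard basis of $\mathbb{Z}^n$, $x^\alpha=x_1^{\alpha_1}\cdots x_n^{\alpha_n}$. A $\sqrt{\mathfrak{gl}_n}$-crystal is a set $\mathcal{B}$ with $\mathrm{wt}:\mathcal{B}\to\mathbb{Z}^n$ and $e_i,f_i:\mathcal{B}\to\mathcal{B}\sqcup\{0\}$ ($i\in[n-1]$, $e_i(0)=f_i(0)=0$) such that, with $\varepsilon_i(b)=\sup\{k\ge0:e_i^k(b)\ne0\}$ and $\varphi_i(b)=\sup\{k\ge0:f_i^k(b)\ne0\}$: (a) both are finite and $\frac{\varphi_i(b)-\varepsilon_i(b)}2=\mathrm{wt}(b)_i-\mathrm{wt}(b)_{i+1}$; (b) $e_i(b)=c$ iff $f_i(c)=b$, and then $\mathrm{wt}(c)-\mathrm{wt}(b)=\mathbf{e}_i$ if $\varepsilon_i(b)$ is even, $-\mathbf{e}_{i+1}$ if odd. An $i$-string is a sequence $D_0,\dots,D_l$ with $e_i(D_0)=0$, $D_j=f_i^j(D_0)$ and $f_i(D_l)=0$. On $\mathbb{Z}[x_1,\dots,x_n]$,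 $\partial_i(f)=\frac{f-s_if}{x_i-x_{i+1}}$ where $s_if$ swaps $x_i$ and $x_{i+1}$, and $\pi^K_i(f)=\partial_i((1+x_{i+1})x_if)$. -}

module Defs where

open import Data.Nat as ℕ using (ℕ; zero; suc; _%_)
open import Data.Integer as ℤ using (ℤ; +_; _-_)
open import Data.Fin as Fin using (Fin; inject₁)
open import Data.Vec as Vec using (Vec; lookup; tabulate; zipWith)
open import Data.Vec.Properties using (≡-dec)
open import Data.List as List using (List; []; _∷_; _++_; concatMap)
open import Data.Product using (_×_; _,_; Σ)
open import Data.Maybe using (Maybe; just; nothing; _>>=_)
open import Relation.Nullary using (yes; no; ¬_)
open import Relation.Binary.PropositionalEquality using (_≡_)

Exp : ℕ → Set
Exp n = Vec ℤ n

_+ᵉ_ : ∀ {n} → Exp n → Exp n → Exp n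
_+ᵉ_ = zipWith ℤ._+_

_-ᵉ_ : ∀ {n} → Exp n → Exp n → Exp n
_-ᵉ_ = zipWith ℤ._-_

unitE : ∀ {n} → Fin n → Exp n
unitE k = tabulate (λ j → if? j)
  where
  if? : _ → ℤ
  if? j with j Fin.≟ k
  ... | yes _ = + 1
  ... | no  _ = + 0

-- Laurent polynomials in x_1..x_n with ℤ coefficients, as finite
-- formal sums of terms (coefficient, exponent), compared by coefficients.

Poly : ℕ → Set
Poly n = List (ℤ × Exp n)

coeff : ∀ {n} → Poly n → Exp n → ℤ
coeff [] β = + 0
coeff ((c , α) ∷ p) β with ≡-dec ℤ._≟_ α β
... | yes _ = c ℤ.+ coeff p β
... | no  _ = coeff p β

infix 4 _≈_
_≈_ : ∀ {n} → Poly n → Poly n → Set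
p ≈ q = ∀ β → coeff p β ≡ coeff q β

mono : ∀ {n} → Exp n → Poly n
mono α = (+ 1 , α) ∷ []

var : ∀ {n} → Fin n → Poly n
var k = mono (unitE k)

one : ∀ {n} → Poly n
one {n} = mono (Vec.replicate n (+ 0))

_⊕_ : ∀ {n} → Poly n → Poly n → Poly n
_⊕_ = _++_

neg : ∀ {n} → Poly n → Poly n
neg = List.map (λ { (c , α) → (ℤ.- c , α) })

_⊖_ : ∀ {n} → Poly n → Poly n → Poly n
p ⊖ q = p ⊕ neg q

_⊗_ : ∀ {n} → Poly n → Poly n → Poly n
p ⊗ q = concatMap (λ { (c , α) → List.map (λ { (d , γ) → (c ℤ.* d , α +ᵉ γ) }) q }) p

sumP : ∀ {n k} → (Fin k → Poly n) → Poly n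
sumP {k = zero}  g = []
sumP {k = suc k} g = g Fin.zero ⊕ sumP (λ j → g (Fin.suc j))

-- gl_n with n = suc m: the index i ∈ [n-1] is i : Fin m; position i is
-- inject₁ i and position i+1 is Fin.suc i (both in Fin (suc m)).

τ : ∀ {m} → Fin m → Fin (suc m) → Fin (suc m)
τ i k with k Fin.≟ inject₁ i
... | yes _ = Fin.suc i
... | no _ with k Fin.≟ Fin.suc i
...   | yes _ = inject₁ i
...   | no _  = k

sᵢ : ∀ {m} → Fin m → Poly (suc m) → Poly (suc m)
sᵢ i = List.map (λ { (c , α) → (c , tabulate (λ k → lookup α (τ i k))) })

-- "∂_i f = g", i.e. g = (f - s_i f)/(x_i - x_{i+1}); since x_i - x_{i+1}
-- is a non-zero-divisor, this determines g uniquely.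
IsDivDiff : ∀ {m} → Fin m → Poly (suc m) → Poly (suc m) → Set
IsDivDiff i f g = ((var (inject₁ i) ⊖ var (Fin.suc i)) ⊗ g) ≈ (f ⊖ sᵢ i f)

IsPiK : ∀ {m} → Fin m → Poly (suc m) → Poly (suc m) → Set
IsPiK i f g = IsDivDiff i (((one ⊕ var (Fin.suc i)) ⊗ var (inject₁ i)) ⊗ f) g

-- √gl_n-crystals (n = suc m).  Partial maps e_i, f_i : B → B ⊔ {0}
-- are B → Maybe B (nothing = 0).

iter : ∀ {B : Set} → (B → Maybe B) → ℕ → B → Maybe B
iter g zero    b = just b
iter g (suc k) b = iter g k b >>= g

record SqrtGlCrystal (m : ℕ) : Set₁ where
  field
    B   : Set
    wt  : B → Exp (suc m)
    e f : Fin m → B → Maybe B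
    -- ε_i(b) = sup{k ≥ 0 : e_i^k b ≠ 0}, φ_i(b) = sup{k : f_i^k b ≠ 0},
    -- both finite: e_i^{ε} b ≠ 0 and e_i^{ε+1} b = 0 (the set is
    -- downward closed since e_i(0) = 0), similarly for φ.
    ε φ : Fin m → B → ℕ
    ε-attained : ∀ i b → ¬ (iter (e i) (ε i b) b ≡ nothing)
    ε-sup      : ∀ i b → iter (e i) (suc (ε i b)) b ≡ nothing
    φ-attained : ∀ i b → ¬ (iter (f i) (φ i b) b ≡ nothing)
    φ-sup      : ∀ i b → iter (f i) (suc (φ i b)) b ≡ nothing
    axiom-a : ∀ i b → (+ φ i b) - (+ ε i b)
                ≡ + 2 ℤ.* (lookup (wt b) (inject₁ i) - lookup (wt b) (Fin.suc i))
    e⇒f : ∀ i b c → e i b ≡ just c → f i c ≡ just b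
    f⇒e : ∀ i b c → f i c ≡ just b → e i b ≡ just c
    wt-even : ∀ i b c → e i b ≡ just c → ε i b % 2 ≡ 0 →
                wt c -ᵉ wt b ≡ unitE (inject₁ i)
    wt-odd  : ∀ i b c → e i b ≡ just c → ε i b % 2 ≡ 1 →
                wt c -ᵉ wt b ≡ Vec.map ℤ.-_ (unitE (Fin.suc i))

record IsString {m} (C : SqrtGlCrystal m) (i : Fin m) (l : ℕ)
                (D : Fin (suc l) → SqrtGlCrystal.B C) : Set where
  open SqrtGlCrystal C
  field
    top  : e i (D Fin.zero) ≡ nothing
    iter≡ : ∀ (j : Fin (suc l)) → iter (f i) (Fin.toℕ j) (D Fin.zero) ≡ just (D j)
    bot  : f i (D (Fin.fromℕ l)) ≡ nothing

{-# OPTIONS --safe #-}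

-- Along an i-string the axioms give ε(D_j) = j and φ(D_0) = l, so l = 2⟨wt D_0, h_i⟩ = 2K, and
-- the parity rule for the weight change gives wt D_j = w_j := α + ⌈j/2⌉ e_{i+1} - ⌊j/2⌋ e_i,
-- α = wt D_0. Then S = Σ_j x^w_j satisfies (x_i - x_{i+1}) S = Σ_j x^(e_i + w_j) - Σ_j x^(e_{i+1} + w_j) with
-- e_i + w_{j+2} = e_{i+1} + w_j, so the difference telescopes to the four monomials of
-- (1 + x_{i+1}) x_i x^α - s_i((1 + x_{i+1}) x_i x^α): the first identity. The reflection s_i
-- reverses the string, s_i w_j = w_{l-j}, so s_i(x^δ S) = x^(s_i δ) S; writing
-- (1 + x_{i+1}) x_i = x_i + x_{i+1} x_i, the second identity becomes
-- (x_i + x_{i+1} x_i) S - (x_{i+1} + x_{i+1} x_i) S = (x_i - x_{i+1}) S.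

module Submission where

open import Defs
open import Data.Nat using (ℕ; suc)
open import Data.Fin using (Fin; zero)
open import Data.Product using (_×_)

open import Data.Empty using (⊥-elim)
open import Data.Fin as Fin using (inject₁; toℕ; fromℕ; opposite)
open import Data.Fin.Induction using (<-weakInduction)
import Data.Fin.Permutation as Perm
import Data.Fin.Properties as Fin
open import Data.Integer using (ℤ; +_; -[1+_]; _+_; _*_; -_; _-_)
import Data.Integer.Properties as ℤ
open import Algebra.Properties.CommutativeMonoid.Sum ℤ.+-0-commutativeMonoid using (sum; sum-init-last; sum-permute)
open import Data.Integer.Tactic.RingSolver using (solve-∀)
open import Data.List as List using ([]; _∷_; _++_)
import Data.List.Properties as List
open import Data.Maybe using (Maybe; just; nothing; _>>=_)
open import Data.Nat as ℕ using (_%_; ⌊_/2⌋; ⌈_/2⌉; _≤′_; ≤′-refl; ≤′-step)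
import Data.Nat.Properties as ℕ
open import Data.Product using (_,_; ∃; proj₁; proj₂)
open import Data.Sum using (_⊎_; inj₁; inj₂)
open import Data.Vec as Vec using (lookup; tabulate)
open import Data.Vec.Properties using (≡-dec; lookup-zipWith; lookup-map; lookup∘tabulate; zipWith-identityˡ; zipWith-assoc; zipWith-comm)
open import Data.Vec.Relation.Binary.Pointwise.Extensional using (ext; Pointwise-≡⇒≡)
open import Function using (_∘_)
open import Level using (0ℓ)
open import Relation.Binary.Bundles using (Setoid)
open import Relation.Binary.Definitions using (tri<; tri≈; tri>)
open import Relation.Binary.PropositionalEquality
import Relation.Binary.Reasoning.Setoid as SetoidReasoning
open import Relation.Nullary using (Dec; yes; no)

-- Laurent polynomials up to ≈

≈-setoid : ℕ → Setoid 0ℓ 0ℓ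
≈-setoid n = record
  { Carrier       = Poly n
  ; _≈_           = _≈_
  ; isEquivalence = record
    { refl  = λ β → refl
    ; sym   = λ p≈q β → sym (p≈q β)
    ; trans = λ p≈q q≈r β → trans (p≈q β) (q≈r β)
    }
  }

module _ {n : ℕ} where

  coeff-⊕ : ∀ (p q : Poly n) β → coeff (p ⊕ q) β ≡ coeff p β + coeff q β
  coeff-⊕ []            q β = sym (ℤ.+-identityˡ _)
  coeff-⊕ ((c , γ) ∷ p) q β with ≡-dec ℤ._≟_ γ β
  ... | yes _ = trans (cong (_+_ c) (coeff-⊕ p q β)) (sym (ℤ.+-assoc c _ _))
  ... | no  _ = coeff-⊕ p q β

  coeff-neg : ∀ (p : Poly n) β → coeff (neg p) β ≡ - coeff p β
  coeff-neg []            β = refl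
  coeff-neg ((c , γ) ∷ p) β with ≡-dec ℤ._≟_ γ β
  ... | yes _ = trans (cong (_+_ (- c)) (coeff-neg p β)) (sym (ℤ.neg-distrib-+ c _))
  ... | no  _ = coeff-neg p β

  coeff-⊖ : ∀ (p q : Poly n) β → coeff (p ⊖ q) β ≡ coeff p β - coeff q β
  coeff-⊖ p q β = trans (coeff-⊕ p (neg q) β) (cong (_+_ (coeff p β)) (coeff-neg q β))

  coeff-sumP : ∀ {k} (G : Fin k → Poly n) β → coeff (sumP G) β ≡ sum (λ j → coeff (G j) β)
  coeff-sumP {ℕ.zero} G β = refl
  coeff-sumP {suc k} G β =
    trans (coeff-⊕ (G zero) _ β) (cong (_+_ (coeff (G zero) β)) (coeff-sumP (G ∘ Fin.suc) β))

  ⊖-cong : ∀ {p p′ q q′ : Poly n} → p ≈ p′ → q ≈ q′ → p ⊖ q ≈ p′ ⊖ q′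
  ⊖-cong {p} {p′} {q} {q′} p≈p′ q≈q′ β = begin
    coeff (p ⊖ q) β          ≡⟨ coeff-⊖ p q β ⟩
    coeff p β - coeff q β    ≡⟨ cong₂ _-_ (p≈p′ β) (q≈q′ β) ⟩
    coeff p′ β - coeff q′ β  ≡⟨ coeff-⊖ p′ q′ β ⟨
    coeff (p′ ⊖ q′) β        ∎
    where open ≡-Reasoning

  ⊕-cong : ∀ {p p′ q q′ : Poly n} → p ≈ p′ → q ≈ q′ → p ⊕ q ≈ p′ ⊕ q′
  ⊕-cong {p} {p′} {q} {q′} p≈p′ q≈q′ β = begin
    coeff (p ⊕ q) β          ≡⟨ coeff-⊕ p q β ⟩
    coeff p β + coeff q β    ≡⟨ cong₂ _+_ (p≈p′ β) (q≈q′ β) ⟩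
    coeff p′ β + coeff q′ β  ≡⟨ coeff-⊕ p′ q′ β ⟨
    coeff (p′ ⊕ q′) β        ∎
    where open ≡-Reasoning

  ⊕-⊖-cancelʳ : ∀ (p q r : Poly n) → (p ⊕ q) ⊖ (r ⊕ q) ≈ p ⊖ r
  ⊕-⊖-cancelʳ p q r β = begin
    coeff ((p ⊕ q) ⊖ (r ⊕ q)) β                             ≡⟨ coeff-⊖ (p ⊕ q) (r ⊕ q) β ⟩
    coeff (p ⊕ q) β - coeff (r ⊕ q) β                       ≡⟨ cong₂ _-_ (coeff-⊕ p q β) (coeff-⊕ r q β) ⟩
    (coeff p β + coeff q β) - (coeff r β + coeff q β)       ≡⟨ cancel (coeff p β) (coeff q β) (coeff r β) ⟩
    coeff p β - coeff r β                                   ≡⟨ coeff-⊖ p r β ⟨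
    coeff (p ⊖ r) β                                         ∎
    where
    open ≡-Reasoning
    cancel : ∀ a b c → (a + b) - (c + b) ≡ a - c
    cancel = solve-∀

  sumP-cong : ∀ {k} {G H : Fin k → Poly n} → (∀ j → G j ≡ H j) → sumP G ≡ sumP H
  sumP-cong {ℕ.zero} G≡H = refl
  sumP-cong {suc k} G≡H = cong₂ _⊕_ (G≡H zero) (sumP-cong (G≡H ∘ Fin.suc))

  sumP-reverse : ∀ {k} (G : Fin k → Poly n) → sumP G ≈ sumP (G ∘ opposite)
  sumP-reverse G β = begin
    coeff (sumP G) β                        ≡⟨ coeff-sumP G β ⟩
    sum (λ j → coeff (G j) β)               ≡⟨ sum-permute (λ j → coeff (G j) β) Perm.reverse ⟩
    sum (λ j → coeff (G (opposite j)) β)    ≡⟨ coeff-sumP (G ∘ opposite) β ⟨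
    coeff (sumP (G ∘ opposite)) β           ∎
    where open ≡-Reasoning

  sumP-telescope : ∀ {k} (a b : Fin (suc (suc k)) → Poly n) →
                   (∀ j → a (Fin.suc (Fin.suc j)) ≡ b (inject₁ (inject₁ j))) →
                   sumP a ⊖ sumP b ≈ (a zero ⊕ a (Fin.suc zero)) ⊖ (b (fromℕ (suc k)) ⊕ b (inject₁ (fromℕ k)))
  sumP-telescope {k} a b a≡b β = begin
    coeff (sumP a ⊖ sumP b) β                         ≡⟨ coeff-⊖ (sumP a) (sumP b) β ⟩
    coeff (sumP a) β - coeff (sumP b) β               ≡⟨ cong₂ _-_ (coeff-⊕ (a zero) _ β) (coeff-sumP b β) ⟩
    A₀ + coeff (a (Fin.suc zero) ⊕ sumP a₊₂) β - sum (λ j → coeff (b j) β)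
      ≡⟨ cong₂ (λ x y → A₀ + x - y) (coeff-⊕ (a (Fin.suc zero)) _ β) (sum-init-last (λ j → coeff (b j) β)) ⟩
    A₀ + (A₁ + coeff (sumP a₊₂) β) - (sum (λ j → coeff (b (inject₁ j)) β) + B₂)
      ≡⟨ cong (λ x → A₀ + (A₁ + coeff (sumP a₊₂) β) - (x + B₂)) (sum-init-last (λ j → coeff (b (inject₁ j)) β)) ⟩
    A₀ + (A₁ + coeff (sumP a₊₂) β) - (sum (λ j → coeff (b₋₂ j) β) + B₁ + B₂)
      ≡⟨ cong (λ x → A₀ + (A₁ + coeff (sumP a₊₂) β) - (x + B₁ + B₂)) (coeff-sumP b₋₂ β) ⟨
    A₀ + (A₁ + coeff (sumP a₊₂) β) - (coeff (sumP b₋₂) β + B₁ + B₂)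
      ≡⟨ cong (λ p → A₀ + (A₁ + coeff (sumP a₊₂) β) - (coeff p β + B₁ + B₂)) (sumP-cong a≡b) ⟨
    A₀ + (A₁ + coeff (sumP a₊₂) β) - (coeff (sumP a₊₂) β + B₁ + B₂)
      ≡⟨ telescope A₀ A₁ (coeff (sumP a₊₂) β) B₁ B₂ ⟩
    (A₀ + A₁) - (B₂ + B₁)
      ≡⟨ cong₂ _-_ (coeff-⊕ (a zero) _ β) (coeff-⊕ (b (fromℕ (suc k))) _ β) ⟨
    coeff (a zero ⊕ a (Fin.suc zero)) β - coeff (b (fromℕ (suc k)) ⊕ b (inject₁ (fromℕ k))) β
      ≡⟨ coeff-⊖ (a zero ⊕ a (Fin.suc zero)) _ β ⟨
    coeff ((a zero ⊕ a (Fin.suc zero)) ⊖ (b (fromℕ (suc k)) ⊕ b (inject₁ (fromℕ k)))) β ∎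
    where
    open ≡-Reasoning
    a₊₂ = a ∘ Fin.suc ∘ Fin.suc
    b₋₂ = b ∘ inject₁ ∘ inject₁
    A₀ = coeff (a zero) β
    A₁ = coeff (a (Fin.suc zero)) β
    B₁ = coeff (b (inject₁ (fromℕ k))) β
    B₂ = coeff (b (fromℕ (suc k))) β
    telescope : ∀ a₀ a₁ x b₁ b₂ → a₀ + (a₁ + x) - (x + b₁ + b₂) ≡ (a₀ + a₁) - (b₂ + b₁)
    telescope = solve-∀

  sumMono : ∀ {k} → (Fin k → Exp n) → Poly n
  sumMono w = sumP (λ j → mono (w j))

  map-sumP : ∀ {k} (h : ℤ × Exp n → ℤ × Exp n) (G : Fin k → Poly n) →
             List.map h (sumP G) ≡ sumP (List.map h ∘ G)
  map-sumP {ℕ.zero} h G = refl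
  map-sumP {suc k}  h G =
    trans (List.map-++ h (G zero) _) (cong (List.map h (G zero) ++_) (map-sumP h (G ∘ Fin.suc)))

  ⊗-distribʳ-⊕ : ∀ (p q r : Poly n) → (p ⊕ q) ⊗ r ≡ (p ⊗ r) ⊕ (q ⊗ r)
  ⊗-distribʳ-⊕ []      q r = refl
  ⊗-distribʳ-⊕ ((c , γ) ∷ p) q r =
    trans (cong (c·xᵞ·r ++_) (⊗-distribʳ-⊕ p q r)) (sym (List.++-assoc c·xᵞ·r (p ⊗ r) (q ⊗ r)))
    where c·xᵞ·r = List.map (λ { (d , δ) → (c * d , γ +ᵉ δ) }) r

  mono-⊗-sumMono : ∀ {k} γ (w : Fin k → Exp n) → mono γ ⊗ sumMono w ≡ sumMono (λ j → γ +ᵉ w j)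
  mono-⊗-sumMono γ w = trans (List.++-identityʳ _) (map-sumP _ (λ j → mono (w j)))

  neg-mono-⊗-sumMono : ∀ {k} γ (w : Fin k → Exp n) →
                       neg (mono γ) ⊗ sumMono w ≡ neg (sumMono (λ j → γ +ᵉ w j))
  neg-mono-⊗-sumMono γ w =
    trans (List.++-identityʳ _) (trans (map-sumP _ (λ j → mono (w j))) (sym (map-sumP _ (λ j → mono (γ +ᵉ w j)))))

module _ {n : ℕ} where

  ≡-by-lookup : ∀ {γ δ : Exp n} → (∀ p → lookup γ p ≡ lookup δ p) → γ ≡ δ
  ≡-by-lookup eq = Pointwise-≡⇒≡ (ext eq)

  lookup-+ᵉ : ∀ (γ δ : Exp n) p → lookup (γ +ᵉ δ) p ≡ lookup γ p + lookup δ p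
  lookup-+ᵉ γ δ p = lookup-zipWith _+_ p γ δ

  lookup--ᵉ : ∀ (γ δ : Exp n) p → lookup (γ -ᵉ δ) p ≡ lookup γ p - lookup δ p
  lookup--ᵉ γ δ p = lookup-zipWith _-_ p γ δ

  +ᵉ-identityˡ : ∀ (γ : Exp n) → Vec.replicate n (+ 0) +ᵉ γ ≡ γ
  +ᵉ-identityˡ = zipWith-identityˡ ℤ.+-identityˡ

  +ᵉ-assoc : ∀ (γ δ ε : Exp n) → (γ +ᵉ δ) +ᵉ ε ≡ γ +ᵉ (δ +ᵉ ε)
  +ᵉ-assoc = zipWith-assoc ℤ.+-assoc

  +ᵉ-comm : ∀ (γ δ : Exp n) → γ +ᵉ δ ≡ δ +ᵉ γ
  +ᵉ-comm = zipWith-comm ℤ.+-comm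

  -ᵉ-cancelˡ : ∀ {γ δ δ′ : Exp n} → γ -ᵉ δ ≡ γ -ᵉ δ′ → δ ≡ δ′
  -ᵉ-cancelˡ {γ} {δ} {δ′} eq = ≡-by-lookup λ p → begin
    lookup δ p                               ≡⟨ x-[x-y]≡y (lookup γ p) (lookup δ p) ⟨
    lookup γ p - (lookup γ p - lookup δ p)   ≡⟨ cong (λ z → lookup γ p - z) (lookup--ᵉ γ δ p) ⟨
    lookup γ p - lookup (γ -ᵉ δ) p           ≡⟨ cong (λ ε → lookup γ p - lookup ε p) eq ⟩
    lookup γ p - lookup (γ -ᵉ δ′) p          ≡⟨ cong (λ z → lookup γ p - z) (lookup--ᵉ γ δ′ p) ⟩
    lookup γ p - (lookup γ p - lookup δ′ p)  ≡⟨ x-[x-y]≡y (lookup γ p) (lookup δ′ p) ⟩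
    lookup δ′ p                              ∎
    where
    open ≡-Reasoning
    x-[x-y]≡y : ∀ x y → x - (x - y) ≡ y
    x-[x-y]≡y = solve-∀

  _·ᵉ_ : ℤ → Exp n → Exp n
  a ·ᵉ γ = Vec.map (a *_) γ

  -- unitE's entries are a with-function on j Fin.≟ k; abstracting p Fin.≟ k in the type
  -- of this equation lets them compute.
  private
    lookup-tabulate′ : ∀ {f : Fin n → ℤ} (γ : Exp n) → γ ≡ tabulate f → ∀ p → lookup γ p ≡ f p
    lookup-tabulate′ γ refl = lookup∘tabulate _

  lookup-unitE-≡ : ∀ (k : Fin n) → lookup (unitE k) k ≡ + 1
  lookup-unitE-≡ k with k Fin.≟ k | lookup-tabulate′ (unitE k) refl k
  ... | yes _   | eq = eq
  ... | no k≢k  | _  = ⊥-elim (k≢k refl)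

  lookup-unitE-≢ : ∀ {k p : Fin n} → p ≢ k → lookup (unitE k) p ≡ + 0
  lookup-unitE-≢ {k} {p} p≢k with p Fin.≟ k | lookup-tabulate′ (unitE k) refl p
  ... | yes p≡k | _  = ⊥-elim (p≢k p≡k)
  ... | no _    | eq = eq

-- The simple root i

module Root {m : ℕ} (i : Fin m) where

  eᵢ eᵢ₊₁ : Exp (suc m)
  eᵢ   = unitE (inject₁ i)
  eᵢ₊₁ = unitE (Fin.suc i)

  hᵢ : Exp (suc m) → ℤ
  hᵢ γ = lookup γ (inject₁ i) - lookup γ (Fin.suc i)

  swapᵉ : Exp (suc m) → Exp (suc m)
  swapᵉ γ = tabulate (λ k → lookup γ (τ i k))

  private
    inject₁≢suc : inject₁ i ≢ Fin.suc i
    inject₁≢suc eq = ℕ.1+n≢n (trans (sym (cong toℕ eq)) (Fin.toℕ-inject₁ i))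

    τ-inject₁ : τ i (inject₁ i) ≡ Fin.suc i
    τ-inject₁ with inject₁ i Fin.≟ inject₁ i
    ... | yes _  = refl
    ... | no i≢i = ⊥-elim (i≢i refl)

    τ-suc : τ i (Fin.suc i) ≡ inject₁ i
    τ-suc with Fin.suc i Fin.≟ inject₁ i
    ... | yes eq = ⊥-elim (inject₁≢suc (sym eq))
    ... | no _ with Fin.suc i Fin.≟ Fin.suc i
    ...   | yes _  = refl
    ...   | no i≢i = ⊥-elim (i≢i refl)

    τ-other : ∀ {p} → p ≢ inject₁ i → p ≢ Fin.suc i → τ i p ≡ p
    τ-other {p} p≢i p≢i+1 with p Fin.≟ inject₁ i
    ... | yes p≡i = ⊥-elim (p≢i p≡i)
    ... | no _ with p Fin.≟ Fin.suc i
    ...   | yes p≡i+1 = ⊥-elim (p≢i+1 p≡i+1)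
    ...   | no _      = refl

  lookup-swapᵉ : ∀ γ p → lookup (swapᵉ γ) p ≡ lookup γ p + hᵢ γ * (lookup eᵢ₊₁ p - lookup eᵢ p)
  lookup-swapᵉ γ p = trans (lookup∘tabulate (lookup γ ∘ τ i) p) (reflect p (p Fin.≟ inject₁ i) (p Fin.≟ Fin.suc i))
    where
    reflect : ∀ p → Dec (p ≡ inject₁ i) → Dec (p ≡ Fin.suc i) →
              lookup γ (τ i p) ≡ lookup γ p + hᵢ γ * (lookup eᵢ₊₁ p - lookup eᵢ p)
    reflect _ (yes refl) _
      rewrite τ-inject₁ | lookup-unitE-≡ (inject₁ i) | lookup-unitE-≢ inject₁≢suc
      = at-i (lookup γ (inject₁ i)) (lookup γ (Fin.suc i))
      where at-i : ∀ a b → b ≡ a + (a - b) * (+ 0 - + 1)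
            at-i = solve-∀
    reflect _ (no p≢i) (yes refl)
      rewrite τ-suc | lookup-unitE-≡ (Fin.suc i) | lookup-unitE-≢ p≢i
      = at-i+1 (lookup γ (inject₁ i)) (lookup γ (Fin.suc i))
      where at-i+1 : ∀ a b → a ≡ b + (a - b) * (+ 1 - + 0)
            at-i+1 = solve-∀
    reflect p (no p≢i) (no p≢i+1)
      rewrite τ-other p≢i p≢i+1 | lookup-unitE-≢ p≢i | lookup-unitE-≢ p≢i+1
      = elsewhere (lookup γ p) (hᵢ γ)
      where elsewhere : ∀ a k → a ≡ a + k * (+ 0 - + 0)
            elsewhere = solve-∀

  hᵢ-+ᵉ : ∀ γ δ → hᵢ (γ +ᵉ δ) ≡ hᵢ γ + hᵢ δ
  hᵢ-+ᵉ γ δ = trans (cong₂ _-_ (lookup-+ᵉ γ δ _) (lookup-+ᵉ γ δ _))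
                    (interchange (lookup γ _) (lookup δ _) (lookup γ _) (lookup δ _))
    where interchange : ∀ a b c d → (a + b) - (c + d) ≡ (a - c) + (b - d)
          interchange = solve-∀

  hᵢ-eᵢ : hᵢ eᵢ ≡ + 1
  hᵢ-eᵢ = cong₂ _-_ (lookup-unitE-≡ (inject₁ i)) (lookup-unitE-≢ (inject₁≢suc ∘ sym))

  hᵢ-eᵢ₊₁ : hᵢ eᵢ₊₁ ≡ -[1+ 0 ]
  hᵢ-eᵢ₊₁ = cong₂ _-_ (lookup-unitE-≢ inject₁≢suc) (lookup-unitE-≡ (Fin.suc i))

  swapᵉ-fixed : ∀ {γ} → hᵢ γ ≡ + 0 → swapᵉ γ ≡ γ
  swapᵉ-fixed {γ} hᵢγ≡0 = ≡-by-lookup λ p → begin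
    lookup (swapᵉ γ) p                                    ≡⟨ lookup-swapᵉ γ p ⟩
    lookup γ p + hᵢ γ * (lookup eᵢ₊₁ p - lookup eᵢ p)    ≡⟨ cong (λ k → lookup γ p + k * (lookup eᵢ₊₁ p - lookup eᵢ p)) hᵢγ≡0 ⟩
    lookup γ p + + 0 * (lookup eᵢ₊₁ p - lookup eᵢ p)      ≡⟨ ℤ.+-identityʳ (lookup γ p) ⟩
    lookup γ p                                            ∎
    where open ≡-Reasoning

  swapᵉ-eᵢ : swapᵉ eᵢ ≡ eᵢ₊₁
  swapᵉ-eᵢ = ≡-by-lookup λ p → begin
    lookup (swapᵉ eᵢ) p                                     ≡⟨ lookup-swapᵉ eᵢ p ⟩
    lookup eᵢ p + hᵢ eᵢ * (lookup eᵢ₊₁ p - lookup eᵢ p)    ≡⟨ cong (λ k → lookup eᵢ p + k * (lookup eᵢ₊₁ p - lookup eᵢ p)) hᵢ-eᵢ ⟩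
    lookup eᵢ p + + 1 * (lookup eᵢ₊₁ p - lookup eᵢ p)       ≡⟨ u+[v-u]≡v (lookup eᵢ p) (lookup eᵢ₊₁ p) ⟩
    lookup eᵢ₊₁ p                                           ∎
    where
    open ≡-Reasoning
    u+[v-u]≡v : ∀ u v → u + + 1 * (v - u) ≡ v
    u+[v-u]≡v = solve-∀

  swapᵉ-+ᵉ : ∀ γ δ → swapᵉ (γ +ᵉ δ) ≡ swapᵉ γ +ᵉ swapᵉ δ
  swapᵉ-+ᵉ γ δ = ≡-by-lookup λ p → begin
    lookup (swapᵉ (γ +ᵉ δ)) p                     ≡⟨ lookup∘tabulate (lookup (γ +ᵉ δ) ∘ τ i) p ⟩
    lookup (γ +ᵉ δ) (τ i p)                       ≡⟨ lookup-+ᵉ γ δ (τ i p) ⟩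
    lookup γ (τ i p) + lookup δ (τ i p)           ≡⟨ cong₂ _+_ (lookup∘tabulate (lookup γ ∘ τ i) p)
                                                               (lookup∘tabulate (lookup δ ∘ τ i) p) ⟨
    lookup (swapᵉ γ) p + lookup (swapᵉ δ) p       ≡⟨ lookup-+ᵉ (swapᵉ γ) (swapᵉ δ) p ⟨
    lookup (swapᵉ γ +ᵉ swapᵉ δ) p                 ∎
    where open ≡-Reasoning

  hᵢ[eᵢ₊₁+eᵢ] : hᵢ (eᵢ₊₁ +ᵉ eᵢ) ≡ + 0
  hᵢ[eᵢ₊₁+eᵢ] = trans (hᵢ-+ᵉ eᵢ₊₁ eᵢ) (cong₂ _+_ hᵢ-eᵢ₊₁ hᵢ-eᵢ)

  sᵢ-⊕ : ∀ p q → sᵢ i (p ⊕ q) ≡ sᵢ i p ⊕ sᵢ i q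
  sᵢ-⊕ p q = List.map-++ _ p q

  [1+xᵢ₊₁]xᵢ : Poly (suc m)
  [1+xᵢ₊₁]xᵢ = (one ⊕ var (Fin.suc i)) ⊗ var (inject₁ i)

  sᵢ-sumMono : ∀ {k} (w : Fin k → Exp (suc m)) → sᵢ i (sumMono w) ≡ sumMono (swapᵉ ∘ w)
  sᵢ-sumMono w = map-sumP _ (λ j → mono (w j))

  [xᵢ-xᵢ₊₁]-⊗-sumMono : ∀ {k} (w : Fin k → Exp (suc m)) →
    (var (inject₁ i) ⊖ var (Fin.suc i)) ⊗ sumMono w ≡ sumMono (λ j → eᵢ +ᵉ w j) ⊖ sumMono (λ j → eᵢ₊₁ +ᵉ w j)
  [xᵢ-xᵢ₊₁]-⊗-sumMono w = trans (⊗-distribʳ-⊕ (var (inject₁ i)) (neg (var (Fin.suc i))) (sumMono w))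
                                (cong₂ _⊕_ (mono-⊗-sumMono eᵢ w) (neg-mono-⊗-sumMono eᵢ₊₁ w))

  [1+xᵢ₊₁]xᵢ-⊗-sumMono : ∀ {k} (w : Fin k → Exp (suc m)) →
    [1+xᵢ₊₁]xᵢ ⊗ sumMono w ≡ sumMono (λ j → (Vec.replicate (suc m) (+ 0) +ᵉ eᵢ) +ᵉ w j) ⊕ sumMono (λ j → (eᵢ₊₁ +ᵉ eᵢ) +ᵉ w j)
  [1+xᵢ₊₁]xᵢ-⊗-sumMono w = trans (⊗-distribʳ-⊕ (mono _) (mono _) (sumMono w))
                                 (cong₂ _⊕_ (mono-⊗-sumMono _ w) (mono-⊗-sumMono _ w))

-- Weights along an i-string

⌈n/2⌉-parity : ∀ n → (n % 2 ≡ 0 × ⌈ n /2⌉ ≡ ⌊ n /2⌋) ⊎ (n % 2 ≡ 1 × ⌈ n /2⌉ ≡ suc ⌊ n /2⌋)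
⌈n/2⌉-parity ℕ.zero          = inj₁ (refl , refl)
⌈n/2⌉-parity (suc ℕ.zero)    = inj₂ (refl , refl)
⌈n/2⌉-parity (suc (suc n)) with ⌈n/2⌉-parity n
... | inj₁ (n%2≡0 , eq) = inj₁ (n%2≡0 , cong suc eq)
... | inj₂ (n%2≡1 , eq) = inj₂ (n%2≡1 , cong suc eq)

halves-complement : ∀ K j d → j ℕ.+ d ≡ K ℕ.+ K →
                    ⌊ j /2⌋ ℕ.+ ⌈ d /2⌉ ≡ K × ⌈ j /2⌉ ℕ.+ ⌊ d /2⌋ ≡ K
halves-complement K ℕ.zero  d d≡2K =
  sym (trans (ℕ.n≡⌈n+n/2⌉ K) (cong ⌈_/2⌉ (sym d≡2K))) , sym (trans (ℕ.n≡⌊n+n/2⌋ K) (cong ⌊_/2⌋ (sym d≡2K)))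
halves-complement K (suc j) d j+d≡2K with halves-complement K j (suc d) (trans (ℕ.+-suc j d) j+d≡2K)
... | f+c≡K , c+f≡K = c+f≡K , trans (sym (ℕ.+-suc ⌊ j /2⌋ ⌊ d /2⌋)) f+c≡K

module Weights {m : ℕ} (i : Fin m) (α : Exp (suc m)) where
  open Root i

  offset : ℤ → ℤ → Exp (suc m)
  offset a b = (α +ᵉ (a ·ᵉ eᵢ₊₁)) -ᵉ (b ·ᵉ eᵢ)

  stringWt : ℕ → Exp (suc m)
  stringWt j = offset (+ ⌈ j /2⌉) (+ ⌊ j /2⌋)

  lookup-offset : ∀ a b p → lookup (offset a b) p ≡ lookup α p + a * lookup eᵢ₊₁ p - b * lookup eᵢ p
  lookup-offset a b p = begin
    lookup (offset a b) p                                     ≡⟨ lookup--ᵉ (α +ᵉ (a ·ᵉ eᵢ₊₁)) (b ·ᵉ eᵢ) p ⟩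
    lookup (α +ᵉ (a ·ᵉ eᵢ₊₁)) p - lookup (b ·ᵉ eᵢ) p          ≡⟨ cong₂ _-_ (lookup-+ᵉ α (a ·ᵉ eᵢ₊₁) p) (lookup-map p (b *_) eᵢ) ⟩
    lookup α p + lookup (a ·ᵉ eᵢ₊₁) p - b * lookup eᵢ p       ≡⟨ cong (λ x → lookup α p + x - b * lookup eᵢ p) (lookup-map p (a *_) eᵢ₊₁) ⟩
    lookup α p + a * lookup eᵢ₊₁ p - b * lookup eᵢ p          ∎
    where open ≡-Reasoning

  private
    module _ (p : Fin (suc m)) where
      A U V : ℤ
      A = lookup α p
      U = lookup eᵢ p
      V = lookup eᵢ₊₁ p

  offset-zero : offset (+ 0) (+ 0) ≡ α
  offset-zero = ≡-by-lookup λ p → trans (lookup-offset (+ 0) (+ 0) p) (no-offset (A p) (V p) (U p))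
    where no-offset : ∀ a v u → a + + 0 * v - + 0 * u ≡ a
          no-offset = solve-∀

  eᵢ+offset : ∀ a b → eᵢ +ᵉ offset a (+ 1 + b) ≡ offset a b
  eᵢ+offset a b = ≡-by-lookup λ p → begin
    lookup (eᵢ +ᵉ offset a (+ 1 + b)) p            ≡⟨ lookup-+ᵉ eᵢ (offset a (+ 1 + b)) p ⟩
    U p + lookup (offset a (+ 1 + b)) p            ≡⟨ cong (_+_ (U p)) (lookup-offset a (+ 1 + b) p) ⟩
    U p + (A p + a * V p - (+ 1 + b) * U p)        ≡⟨ absorb (A p) (U p) (V p) a b ⟩
    A p + a * V p - b * U p                        ≡⟨ lookup-offset a b p ⟨
    lookup (offset a b) p                          ∎
    where
    open ≡-Reasoning
    absorb : ∀ x u v a b → u + (x + a * v - (+ 1 + b) * u) ≡ x + a * v - b * u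
    absorb = solve-∀

  eᵢ₊₁+offset : ∀ a b → eᵢ₊₁ +ᵉ offset a b ≡ offset (+ 1 + a) b
  eᵢ₊₁+offset a b = ≡-by-lookup λ p → begin
    lookup (eᵢ₊₁ +ᵉ offset a b) p                  ≡⟨ lookup-+ᵉ eᵢ₊₁ (offset a b) p ⟩
    V p + lookup (offset a b) p                    ≡⟨ cong (_+_ (V p)) (lookup-offset a b p) ⟩
    V p + (A p + a * V p - b * U p)                ≡⟨ absorb (A p) (U p) (V p) a b ⟩
    A p + (+ 1 + a) * V p - b * U p                ≡⟨ lookup-offset (+ 1 + a) b p ⟨
    lookup (offset (+ 1 + a) b) p                  ∎
    where
    open ≡-Reasoning
    absorb : ∀ x u v a b → v + (x + a * v - b * u) ≡ x + (+ 1 + a) * v - b * u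
    absorb = solve-∀

  hᵢ-offset : ∀ a b → hᵢ (offset a b) ≡ hᵢ α - a - b
  hᵢ-offset a b = begin
    hᵢ (offset a b)
      ≡⟨ cong₂ _-_ (lookup-offset a b (inject₁ i)) (lookup-offset a b (Fin.suc i)) ⟩
    (A (inject₁ i) + a * V (inject₁ i) - b * U (inject₁ i)) - (A (Fin.suc i) + a * V (Fin.suc i) - b * U (Fin.suc i))
      ≡⟨ regroup a b (A (inject₁ i)) (A (Fin.suc i)) (V (inject₁ i)) (V (Fin.suc i)) (U (inject₁ i)) (U (Fin.suc i)) ⟩
    hᵢ α + a * hᵢ eᵢ₊₁ - b * hᵢ eᵢ
      ≡⟨ cong₂ (λ x y → hᵢ α + a * x - b * y) hᵢ-eᵢ₊₁ hᵢ-eᵢ ⟩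
    hᵢ α + a * -[1+ 0 ] - b * + 1
      ≡⟨ evaluate (hᵢ α) a b ⟩
    hᵢ α - a - b ∎
    where
    open ≡-Reasoning
    regroup : ∀ a b x x′ v v′ u u′ → (x + a * v - b * u) - (x′ + a * v′ - b * u′) ≡ (x - x′) + a * (v - v′) - b * (u - u′)
    regroup = solve-∀
    evaluate : ∀ k a b → k + a * -[1+ 0 ] - b * + 1 ≡ k - a - b
    evaluate = solve-∀

  swapᵉ-offset : ∀ a b → swapᵉ (offset a b) ≡ offset (hᵢ α - b) (hᵢ α - a)
  swapᵉ-offset a b = ≡-by-lookup λ p → begin
    lookup (swapᵉ (offset a b)) p
      ≡⟨ lookup-swapᵉ (offset a b) p ⟩
    lookup (offset a b) p + hᵢ (offset a b) * (V p - U p)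
      ≡⟨ cong₂ (λ x k → x + k * (V p - U p)) (lookup-offset a b p) (hᵢ-offset a b) ⟩
    (A p + a * V p - b * U p) + (hᵢ α - a - b) * (V p - U p)
      ≡⟨ reflect (A p) (U p) (V p) (hᵢ α) a b ⟩
    A p + (hᵢ α - b) * V p - (hᵢ α - a) * U p
      ≡⟨ lookup-offset (hᵢ α - b) (hᵢ α - a) p ⟨
    lookup (offset (hᵢ α - b) (hᵢ α - a)) p ∎
    where
    open ≡-Reasoning
    reflect : ∀ x u v k a b → (x + a * v - b * u) + (k - a - b) * (v - u) ≡ x + (k - b) * v - (k - a) * u
    reflect = solve-∀

  offset--ᵉ-offset[1+b] : ∀ a b → offset a b -ᵉ offset a (+ 1 + b) ≡ eᵢ
  offset--ᵉ-offset[1+b] a b = ≡-by-lookup λ p → begin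
    lookup (offset a b -ᵉ offset a (+ 1 + b)) p                          ≡⟨ lookup--ᵉ (offset a b) _ p ⟩
    lookup (offset a b) p - lookup (offset a (+ 1 + b)) p                ≡⟨ cong₂ _-_ (lookup-offset a b p) (lookup-offset a (+ 1 + b) p) ⟩
    (A p + a * V p - b * U p) - (A p + a * V p - (+ 1 + b) * U p)        ≡⟨ difference (A p) (U p) (V p) a b ⟩
    U p                                                                  ∎
    where
    open ≡-Reasoning
    difference : ∀ x u v a b → (x + a * v - b * u) - (x + a * v - (+ 1 + b) * u) ≡ u
    difference = solve-∀

  offset--ᵉ-offset[1+a] : ∀ a b → offset a b -ᵉ offset (+ 1 + a) b ≡ Vec.map -_ eᵢ₊₁
  offset--ᵉ-offset[1+a] a b = ≡-by-lookup λ p → begin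
    lookup (offset a b -ᵉ offset (+ 1 + a) b) p                          ≡⟨ lookup--ᵉ (offset a b) _ p ⟩
    lookup (offset a b) p - lookup (offset (+ 1 + a) b) p                ≡⟨ cong₂ _-_ (lookup-offset a b p) (lookup-offset (+ 1 + a) b p) ⟩
    (A p + a * V p - b * U p) - (A p + (+ 1 + a) * V p - b * U p)        ≡⟨ difference (A p) (U p) (V p) a b ⟩
    - V p                                                                ≡⟨ lookup-map p -_ eᵢ₊₁ ⟨
    lookup (Vec.map -_ eᵢ₊₁) p                                           ∎
    where
    open ≡-Reasoning
    difference : ∀ x u v a b → (x + a * v - b * u) - (x + (+ 1 + a) * v - b * u) ≡ - v
    difference = solve-∀

  [eᵢ₊₁+eᵢ]+α≡eᵢ+stringWt1 : (eᵢ₊₁ +ᵉ eᵢ) +ᵉ α ≡ eᵢ +ᵉ stringWt 1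
  [eᵢ₊₁+eᵢ]+α≡eᵢ+stringWt1 = begin
    (eᵢ₊₁ +ᵉ eᵢ) +ᵉ α                 ≡⟨ cong (_+ᵉ α) (+ᵉ-comm eᵢ₊₁ eᵢ) ⟩
    (eᵢ +ᵉ eᵢ₊₁) +ᵉ α                 ≡⟨ +ᵉ-assoc eᵢ eᵢ₊₁ α ⟩
    eᵢ +ᵉ (eᵢ₊₁ +ᵉ α)                 ≡⟨ cong (λ γ → eᵢ +ᵉ (eᵢ₊₁ +ᵉ γ)) offset-zero ⟨
    eᵢ +ᵉ (eᵢ₊₁ +ᵉ offset (+ 0) (+ 0)) ≡⟨ cong (eᵢ +ᵉ_) (eᵢ₊₁+offset (+ 0) (+ 0)) ⟩
    eᵢ +ᵉ stringWt 1                  ∎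
    where open ≡-Reasoning

  eᵢ+stringWt[2+n] : ∀ n → eᵢ +ᵉ stringWt (2 ℕ.+ n) ≡ eᵢ₊₁ +ᵉ stringWt n
  eᵢ+stringWt[2+n] n = trans (eᵢ+offset (+ suc ⌈ n /2⌉) (+ ⌊ n /2⌋)) (sym (eᵢ₊₁+offset (+ ⌈ n /2⌉) (+ ⌊ n /2⌋)))

  stringWt-step : ∀ n → (suc n % 2 ≡ 0 × stringWt n -ᵉ stringWt (suc n) ≡ eᵢ)
                      ⊎ (suc n % 2 ≡ 1 × stringWt n -ᵉ stringWt (suc n) ≡ Vec.map -_ eᵢ₊₁)
  stringWt-step n with ⌈n/2⌉-parity (suc n)
  ... | inj₁ (even , 1+⌊n/2⌋≡⌈n/2⌉) = inj₁ (even ,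
        subst (λ c → offset (+ c) (+ ⌊ n /2⌋) -ᵉ offset (+ suc ⌊ n /2⌋) (+ c) ≡ eᵢ)
              1+⌊n/2⌋≡⌈n/2⌉ (offset--ᵉ-offset[1+b] (+ suc ⌊ n /2⌋) (+ ⌊ n /2⌋)))
  ... | inj₂ (odd , 1+⌊n/2⌋≡1+⌈n/2⌉) = inj₂ (odd ,
        subst (λ f → offset (+ ⌈ n /2⌉) (+ f) -ᵉ offset (+ suc f) (+ ⌈ n /2⌉) ≡ Vec.map -_ eᵢ₊₁)
              (sym (ℕ.suc-injective 1+⌊n/2⌋≡1+⌈n/2⌉)) (offset--ᵉ-offset[1+a] (+ ⌈ n /2⌉) (+ ⌈ n /2⌉)))

  shiftedSum : ℕ → Exp (suc m) → Poly (suc m)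
  shiftedSum l δ = sumMono {k = suc l} (λ j → δ +ᵉ stringWt (toℕ j))

  module _ (K : ℕ) (hᵢα≡K : hᵢ α ≡ + K) where

    swapᵉ-stringWt : ∀ j d → j ℕ.+ d ≡ K ℕ.+ K → swapᵉ (stringWt j) ≡ stringWt d
    swapᵉ-stringWt j d j+d≡2K = trans (swapᵉ-offset (+ ⌈ j /2⌉) (+ ⌊ j /2⌋)) (cong₂ offset (K-minus f+c≡K) (K-minus c+f≡K))
      where
      f+c≡K = proj₁ (halves-complement K j d j+d≡2K)
      c+f≡K = proj₂ (halves-complement K j d j+d≡2K)
      K-minus : ∀ {x y} → x ℕ.+ y ≡ K → hᵢ α - + x ≡ + y
      K-minus {x} {y} x+y≡K = begin
        hᵢ α - + x        ≡⟨ cong (λ k → k - + x) (trans hᵢα≡K (cong +_ (sym x+y≡K))) ⟩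
        + (x ℕ.+ y) - + x  ≡⟨ cong (λ k → k - + x) (ℤ.pos-+ x y) ⟩
        + x + + y - + x    ≡⟨ cancel (+ x) (+ y) ⟩
        + y                ∎
        where
        open ≡-Reasoning
        cancel : ∀ a b → a + b - a ≡ b
        cancel = solve-∀

    swapᵉ-shifted : ∀ δ j d → j ℕ.+ d ≡ K ℕ.+ K → swapᵉ (δ +ᵉ stringWt j) ≡ swapᵉ δ +ᵉ stringWt d
    swapᵉ-shifted δ j d j+d≡2K = trans (swapᵉ-+ᵉ δ (stringWt j)) (cong (swapᵉ δ +ᵉ_) (swapᵉ-stringWt j d j+d≡2K))

    swapᵉ-eᵢ+stringWt : ∀ j d → j ℕ.+ d ≡ K ℕ.+ K → swapᵉ (eᵢ +ᵉ stringWt j) ≡ eᵢ₊₁ +ᵉ stringWt d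
    swapᵉ-eᵢ+stringWt j d j+d≡2K = trans (swapᵉ-shifted eᵢ j d j+d≡2K) (cong (_+ᵉ stringWt d) swapᵉ-eᵢ)

    -- [1+xᵢ₊₁]xᵢ ⊗ mono α computes to mono E₀ ⊕ mono E₁.
    private
      E₀ E₁ : Exp (suc m)
      E₀ = (Vec.replicate (suc m) (+ 0) +ᵉ eᵢ) +ᵉ α
      E₁ = (eᵢ₊₁ +ᵉ eᵢ) +ᵉ α

      eᵢ+stringWt0≡E₀ : eᵢ +ᵉ stringWt 0 ≡ E₀
      eᵢ+stringWt0≡E₀ = cong₂ _+ᵉ_ (sym (+ᵉ-identityˡ eᵢ)) offset-zero

      endpoints : Exp (suc m) → Exp (suc m) → Exp (suc m) → Exp (suc m) → Poly (suc m)
      endpoints a₀ a₁ b₀ b₁ = (mono a₀ ⊕ mono a₁) ⊖ (mono b₀ ⊕ mono b₁)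

      endpoints-cong : ∀ {a₀ a₁ b₀ b₁ a₀′ a₁′ b₀′ b₁′} → a₀ ≡ a₀′ → a₁ ≡ a₁′ → b₀ ≡ b₀′ → b₁ ≡ b₁′ →
                       endpoints a₀ a₁ b₀ b₁ ≡ endpoints a₀′ a₁′ b₀′ b₁′
      endpoints-cong refl refl refl refl = refl

    [xᵢ-xᵢ₊₁]S-telescopes : ∀ l → l ≡ K ℕ.+ K →
      shiftedSum l eᵢ ⊖ shiftedSum l eᵢ₊₁ ≈ ([1+xᵢ₊₁]xᵢ ⊗ mono α) ⊖ sᵢ i ([1+xᵢ₊₁]xᵢ ⊗ mono α)
    [xᵢ-xᵢ₊₁]S-telescopes ℕ.zero 0≡2K = begin
      mono (eᵢ +ᵉ stringWt 0) ⊖ mono (eᵢ₊₁ +ᵉ stringWt 0)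
        ≈⟨ ⊕-⊖-cancelʳ (mono (eᵢ +ᵉ stringWt 0)) (mono E₁) (mono (eᵢ₊₁ +ᵉ stringWt 0)) ⟨
      endpoints (eᵢ +ᵉ stringWt 0) E₁ (eᵢ₊₁ +ᵉ stringWt 0) E₁
        ≡⟨ endpoints-cong eᵢ+stringWt0≡E₀ refl (sym swapᵉ-E₀) (sym swapᵉ-E₁) ⟩
      endpoints E₀ E₁ (swapᵉ E₀) (swapᵉ E₁) ∎
      where
      open SetoidReasoning (≈-setoid (suc m))
      swapᵉ-E₀ : swapᵉ E₀ ≡ eᵢ₊₁ +ᵉ stringWt 0
      swapᵉ-E₀ = trans (cong swapᵉ (sym eᵢ+stringWt0≡E₀)) (swapᵉ-eᵢ+stringWt 0 0 0≡2K)
      swapᵉ-E₁ : swapᵉ E₁ ≡ E₁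
      swapᵉ-E₁ = swapᵉ-fixed (trans (hᵢ-+ᵉ (eᵢ₊₁ +ᵉ eᵢ) α)
                   (cong₂ _+_ hᵢ[eᵢ₊₁+eᵢ] (trans hᵢα≡K (cong +_ (ℕ.m+n≡0⇒m≡0 K (sym 0≡2K))))))
    [xᵢ-xᵢ₊₁]S-telescopes (suc k) 1+k≡2K = begin
      shiftedSum (suc k) eᵢ ⊖ shiftedSum (suc k) eᵢ₊₁
        ≈⟨ sumP-telescope {k = k} (λ j → mono (eᵢ +ᵉ stringWt (toℕ j))) (λ j → mono (eᵢ₊₁ +ᵉ stringWt (toℕ j))) two-apart ⟩
      endpoints (eᵢ +ᵉ stringWt 0) (eᵢ +ᵉ stringWt 1)
                (eᵢ₊₁ +ᵉ stringWt (toℕ (fromℕ (suc k)))) (eᵢ₊₁ +ᵉ stringWt (toℕ (inject₁ (fromℕ k))))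
        ≡⟨ endpoints-cong eᵢ+stringWt0≡E₀ (sym [eᵢ₊₁+eᵢ]+α≡eᵢ+stringWt1) (sym swapᵉ-E₀) (sym swapᵉ-E₁) ⟩
      endpoints E₀ E₁ (swapᵉ E₀) (swapᵉ E₁) ∎
      where
      open SetoidReasoning (≈-setoid (suc m))
      two-apart : ∀ j → mono (eᵢ +ᵉ stringWt (toℕ (Fin.suc (Fin.suc j)))) ≡ mono (eᵢ₊₁ +ᵉ stringWt (toℕ (inject₁ (inject₁ j))))
      two-apart j = cong mono (trans (eᵢ+stringWt[2+n] (toℕ j))
                    (cong (λ n → eᵢ₊₁ +ᵉ stringWt n) (sym (trans (Fin.toℕ-inject₁ (inject₁ j)) (Fin.toℕ-inject₁ j)))))
      swapᵉ-E₀ : swapᵉ E₀ ≡ eᵢ₊₁ +ᵉ stringWt (toℕ (fromℕ (suc k)))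
      swapᵉ-E₀ = trans (cong swapᵉ (sym eᵢ+stringWt0≡E₀))
                 (trans (swapᵉ-eᵢ+stringWt 0 (suc k) 1+k≡2K)
                        (cong (λ n → eᵢ₊₁ +ᵉ stringWt n) (sym (Fin.toℕ-fromℕ (suc k)))))
      swapᵉ-E₁ : swapᵉ E₁ ≡ eᵢ₊₁ +ᵉ stringWt (toℕ (inject₁ (fromℕ k)))
      swapᵉ-E₁ = trans (cong swapᵉ [eᵢ₊₁+eᵢ]+α≡eᵢ+stringWt1)
                 (trans (swapᵉ-eᵢ+stringWt 1 k 1+k≡2K)
                        (cong (λ n → eᵢ₊₁ +ᵉ stringWt n) (sym (trans (Fin.toℕ-inject₁ (fromℕ k)) (Fin.toℕ-fromℕ k)))))

    module _ (l : ℕ) (l≡2K : l ≡ K ℕ.+ K) where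
      open SetoidReasoning (≈-setoid (suc m))

      sᵢ-shiftedSum : ∀ δ → sᵢ i (shiftedSum l δ) ≈ shiftedSum l (swapᵉ δ)
      sᵢ-shiftedSum δ = begin
        sᵢ i (shiftedSum l δ)
          ≡⟨ sᵢ-sumMono {k = suc l} (λ j → δ +ᵉ stringWt (toℕ j)) ⟩
        sumMono (λ (j : Fin (suc l)) → swapᵉ (δ +ᵉ stringWt (toℕ j)))
          ≡⟨ sumP-cong {k = suc l} (λ j → cong mono (swapᵉ-shifted δ (toℕ j) (toℕ (opposite j)) (reflected j))) ⟩
        sumMono (λ (j : Fin (suc l)) → swapᵉ δ +ᵉ stringWt (toℕ (opposite j)))
          ≈⟨ sumP-reverse {k = suc l} (λ j → mono (swapᵉ δ +ᵉ stringWt (toℕ j))) ⟨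
        shiftedSum l (swapᵉ δ) ∎
        where
        reflected : ∀ (j : Fin (suc l)) → toℕ j ℕ.+ toℕ (opposite j) ≡ K ℕ.+ K
        reflected j = trans (cong (toℕ j ℕ.+_) (Fin.opposite-prop j)) (trans (ℕ.m+[n∸m]≡n (Fin.toℕ≤pred[n] j)) l≡2K)

      S : Poly (suc m)
      S = sumMono {k = suc l} (λ j → stringWt (toℕ j))

      top-isPiK : IsPiK i (mono α) S
      top-isPiK = begin
        (var (inject₁ i) ⊖ var (Fin.suc i)) ⊗ S               ≡⟨ [xᵢ-xᵢ₊₁]-⊗-sumMono {k = suc l} (λ j → stringWt (toℕ j)) ⟩
        shiftedSum l eᵢ ⊖ shiftedSum l eᵢ₊₁                    ≈⟨ [xᵢ-xᵢ₊₁]S-telescopes l l≡2K ⟩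
        ([1+xᵢ₊₁]xᵢ ⊗ mono α) ⊖ sᵢ i ([1+xᵢ₊₁]xᵢ ⊗ mono α)     ∎

      sum-isPiK : IsPiK i S S
      sum-isPiK = begin
        (var (inject₁ i) ⊖ var (Fin.suc i)) ⊗ S               ≡⟨ [xᵢ-xᵢ₊₁]-⊗-sumMono {k = suc l} (λ j → stringWt (toℕ j)) ⟩
        Sᵤ ⊖ Sᵥ                                                ≈⟨ ⊕-⊖-cancelʳ Sᵤ Sᵥᵤ Sᵥ ⟨
        (Sᵤ ⊕ Sᵥᵤ) ⊖ (Sᵥ ⊕ Sᵥᵤ)                                ≈⟨ ⊖-cong {p = Sᵤ ⊕ Sᵥᵤ} {Sᵤ ⊕ Sᵥᵤ} (λ β → refl) sᵢ-image ⟨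
        (Sᵤ ⊕ Sᵥᵤ) ⊖ (sᵢ i Sᵤ ⊕ sᵢ i Sᵥᵤ)                      ≡⟨ cong ((Sᵤ ⊕ Sᵥᵤ) ⊖_) (sᵢ-⊕ Sᵤ Sᵥᵤ) ⟨
        (Sᵤ ⊕ Sᵥᵤ) ⊖ sᵢ i (Sᵤ ⊕ Sᵥᵤ)                           ≡⟨ cong (λ p → p ⊖ sᵢ i p) [1+xᵢ₊₁]xᵢS ⟨
        ([1+xᵢ₊₁]xᵢ ⊗ S) ⊖ sᵢ i ([1+xᵢ₊₁]xᵢ ⊗ S)               ∎
        where
        Sᵤ Sᵥ Sᵥᵤ : Poly (suc m)
        Sᵤ  = shiftedSum l eᵢ
        Sᵥ  = shiftedSum l eᵢ₊₁
        Sᵥᵤ = shiftedSum l (eᵢ₊₁ +ᵉ eᵢ)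
        sᵢSᵤ : sᵢ i Sᵤ ≈ Sᵥ
        sᵢSᵤ = begin
          sᵢ i Sᵤ                  ≈⟨ sᵢ-shiftedSum eᵢ ⟩
          shiftedSum l (swapᵉ eᵢ)  ≡⟨ cong (shiftedSum l) swapᵉ-eᵢ ⟩
          Sᵥ                       ∎
        sᵢSᵥᵤ : sᵢ i Sᵥᵤ ≈ Sᵥᵤ
        sᵢSᵥᵤ = begin
          sᵢ i Sᵥᵤ                             ≈⟨ sᵢ-shiftedSum (eᵢ₊₁ +ᵉ eᵢ) ⟩
          shiftedSum l (swapᵉ (eᵢ₊₁ +ᵉ eᵢ))    ≡⟨ cong (shiftedSum l) (swapᵉ-fixed hᵢ[eᵢ₊₁+eᵢ]) ⟩
          Sᵥᵤ                                  ∎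
        sᵢ-image : sᵢ i Sᵤ ⊕ sᵢ i Sᵥᵤ ≈ Sᵥ ⊕ Sᵥᵤ
        sᵢ-image = ⊕-cong {p = sᵢ i Sᵤ} {Sᵥ} {sᵢ i Sᵥᵤ} {Sᵥᵤ} sᵢSᵤ sᵢSᵥᵤ
        [1+xᵢ₊₁]xᵢS : [1+xᵢ₊₁]xᵢ ⊗ S ≡ Sᵤ ⊕ Sᵥᵤ
        [1+xᵢ₊₁]xᵢS = trans ([1+xᵢ₊₁]xᵢ-⊗-sumMono {k = suc l} (λ j → stringWt (toℕ j)))
                            (cong (λ δ → shiftedSum l δ ⊕ Sᵥᵤ) (+ᵉ-identityˡ eᵢ))

-- i-strings in a √gl_n-crystal

module _ {B : Set} (g : B → Maybe B) where

  iter-suc : ∀ k b → iter g (suc k) b ≡ (g b >>= iter g k)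
  iter-suc ℕ.zero b with g b
  ... | just _  = refl
  ... | nothing = refl
  iter-suc (suc k) b rewrite iter-suc k b with g b
  ... | just _  = refl
  ... | nothing = refl

  iter-nothing : ∀ {b n n′} → n ≤′ n′ → iter g n b ≡ nothing → iter g n′ b ≡ nothing
  iter-nothing ≤′-refl        dead = dead
  iter-nothing (≤′-step n≤n′) dead = cong (_>>= g) (iter-nothing n≤n′ dead)

  iter-length-unique : ∀ {b n n′} → iter g n b ≢ nothing → iter g (suc n) b ≡ nothing →
                       iter g n′ b ≢ nothing → iter g (suc n′) b ≡ nothing → n ≡ n′
  iter-length-unique {n = n} {n′} alive dead alive′ dead′ with ℕ.<-cmp n n′
  ... | tri< n<n′ _ _ = ⊥-elim (alive′ (iter-nothing (ℕ.≤⇒≤′ n<n′) dead))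
  ... | tri≈ _ n≡n′ _ = n≡n′
  ... | tri> _ _ n′<n = ⊥-elim (alive (iter-nothing (ℕ.≤⇒≤′ n′<n) dead′))

just≢nothing : ∀ {A : Set} {x : A} → just x ≢ nothing
just≢nothing ()

module CrystalString {m : ℕ} (C : SqrtGlCrystal m) {i : Fin m} {l : ℕ}
                     {D : Fin (suc l) → SqrtGlCrystal.B C} (string : IsString C i l D) where
  open SqrtGlCrystal C
  open IsString string
  open Root i
  open Weights i (wt (D zero)) using (stringWt; offset-zero; stringWt-step)
  open ≡-Reasoning

  f-step : ∀ j → f i (D (inject₁ j)) ≡ just (D (Fin.suc j))
  f-step j = begin
    f i (D (inject₁ j))                              ≡⟨ cong (_>>= f i) (iter≡ (inject₁ j)) ⟨
    (iter (f i) (toℕ (inject₁ j)) (D zero) >>= f i)  ≡⟨ cong (λ n → iter (f i) n (D zero) >>= f i) (Fin.toℕ-inject₁ j) ⟩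
    iter (f i) (suc (toℕ j)) (D zero)                ≡⟨ iter≡ (Fin.suc j) ⟩
    just (D (Fin.suc j))                             ∎

  e-step : ∀ j → e i (D (Fin.suc j)) ≡ just (D (inject₁ j))
  e-step j = f⇒e i (D (Fin.suc j)) (D (inject₁ j)) (f-step j)

  e-iter-to-top : ∀ j → iter (e i) (toℕ j) (D j) ≡ just (D zero)
  e-iter-to-top = <-weakInduction (λ j → iter (e i) (toℕ j) (D j) ≡ just (D zero)) refl step
    where
    step : ∀ j → iter (e i) (toℕ (inject₁ j)) (D (inject₁ j)) ≡ just (D zero) →
           iter (e i) (suc (toℕ j)) (D (Fin.suc j)) ≡ just (D zero)
    step j reaches-top = begin
      iter (e i) (suc (toℕ j)) (D (Fin.suc j))        ≡⟨ iter-suc (e i) (toℕ j) (D (Fin.suc j)) ⟩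
      (e i (D (Fin.suc j)) >>= iter (e i) (toℕ j))    ≡⟨ cong (_>>= iter (e i) (toℕ j)) (e-step j) ⟩
      iter (e i) (toℕ j) (D (inject₁ j))              ≡⟨ cong (λ n → iter (e i) n (D (inject₁ j))) (Fin.toℕ-inject₁ j) ⟨
      iter (e i) (toℕ (inject₁ j)) (D (inject₁ j))    ≡⟨ reaches-top ⟩
      just (D zero)                                   ∎

  ε-string : ∀ j → ε i (D j) ≡ toℕ j
  ε-string j = iter-length-unique (e i) (ε-attained i (D j)) (ε-sup i (D j))
                 (just≢nothing ∘ trans (sym (e-iter-to-top j))) (trans (cong (_>>= e i) (e-iter-to-top j)) top)

  φ-top : φ i (D zero) ≡ l
  φ-top = iter-length-unique (f i) (φ-attained i (D zero)) (φ-sup i (D zero))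
            (just≢nothing ∘ trans (sym reaches-bottom)) (trans (cong (_>>= f i) reaches-bottom) bot)
    where
    reaches-bottom : iter (f i) l (D zero) ≡ just (D (fromℕ l))
    reaches-bottom = trans (cong (λ n → iter (f i) n (D zero)) (sym (Fin.toℕ-fromℕ l))) (iter≡ (fromℕ l))

  length≡2hᵢ[wt] : + l ≡ + 2 * hᵢ (wt (D zero))
  length≡2hᵢ[wt] = begin
    + l                                  ≡⟨ ℤ.+-identityʳ (+ l) ⟨
    + l - + 0                            ≡⟨ cong₂ (λ a b → + a - + b) φ-top (ε-string zero) ⟨
    + φ i (D zero) - + ε i (D zero)      ≡⟨ axiom-a i (D zero) ⟩
    + 2 * hᵢ (wt (D zero))                ∎

  wt-string : ∀ j → wt (D j) ≡ stringWt (toℕ j)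
  wt-string = <-weakInduction (λ j → wt (D j) ≡ stringWt (toℕ j)) (sym offset-zero) step
    where
    step : ∀ j → wt (D (inject₁ j)) ≡ stringWt (toℕ (inject₁ j)) → wt (D (Fin.suc j)) ≡ stringWt (suc (toℕ j))
    step j wt-prev = -ᵉ-cancelˡ (begin
      stringWt (toℕ j) -ᵉ wt (D (Fin.suc j))       ≡⟨ cong (_-ᵉ wt (D (Fin.suc j))) wt-prev′ ⟨
      wt (D (inject₁ j)) -ᵉ wt (D (Fin.suc j))     ≡⟨ same-change ⟩
      stringWt (toℕ j) -ᵉ stringWt (suc (toℕ j))   ∎)
      where
      wt-prev′ : wt (D (inject₁ j)) ≡ stringWt (toℕ j)
      wt-prev′ = trans wt-prev (cong stringWt (Fin.toℕ-inject₁ j))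
      same-change : wt (D (inject₁ j)) -ᵉ wt (D (Fin.suc j)) ≡ stringWt (toℕ j) -ᵉ stringWt (suc (toℕ j))
      same-change with stringWt-step (toℕ j)
      ... | inj₁ (even , Δ) = trans (wt-even i _ _ (e-step j) (trans (cong (_% 2) (ε-string (Fin.suc j))) even)) (sym Δ)
      ... | inj₂ (odd , Δ)  = trans (wt-odd i _ _ (e-step j) (trans (cong (_% 2) (ε-string (Fin.suc j))) odd)) (sym Δ)

half-of-doubled : ∀ {l d} → + l ≡ + 2 * d → ∃ λ K → d ≡ + K × l ≡ K ℕ.+ K
half-of-doubled {l} {+ K} l≡2K = K , refl , trans (ℤ.+-injective (trans l≡2K (sym (ℤ.pos-* 2 K)))) (cong (K ℕ.+_) (ℕ.+-identityʳ K))
half-of-doubled {d = -[1+ _ ]} ()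

lemma4p13 : ∀ {m : ℕ} (C : SqrtGlCrystal m) (i : Fin m) (l : ℕ)
    (D : Fin (suc l) → SqrtGlCrystal.B C) → IsString C i l D →
    IsPiK i (mono (SqrtGlCrystal.wt C (D zero))) (sumP (λ j → mono (SqrtGlCrystal.wt C (D j))))
    × IsPiK i (sumP (λ j → mono (SqrtGlCrystal.wt C (D j)))) (sumP (λ j → mono (SqrtGlCrystal.wt C (D j))))
lemma4p13 C i l D string with half-of-doubled (CrystalString.length≡2hᵢ[wt] C string)
... | K , hᵢα≡K , l≡2K =
  subst (λ S → IsPiK i (mono α) S × IsPiK i S S) (sym S≡stringSum)
        (Weights.top-isPiK i α K hᵢα≡K l l≡2K , Weights.sum-isPiK i α K hᵢα≡K l l≡2K)
  where
  α = SqrtGlCrystal.wt C (D zero)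
  S≡stringSum : sumP (λ j → mono (SqrtGlCrystal.wt C (D j))) ≡ Weights.S i α K hᵢα≡K l l≡2K
  S≡stringSum = sumP-cong (λ j → cong mono (CrystalString.wt-string C string j))
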